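{- Every $\Sigma^1_1\text{ - }\mathrm{KROM}^r$ formula is equivalent to a formula of the form $\exists\bar{y}_1\phi_1\vee\cdots\vee\exists\bar{y}_n\phi_n$, where each $\phi_i$ ($1\le i\le n$) is a $\Sigma^1_1\text{ - }\mathrm{KROM}$ formula (whose free first-order variables are among $\bar{y}_i$).
   Context: Vocabularies $\tau$ consist of constant and relation symbols and always contain equality; all structures are finite. Second-order Krom logic $\mathrm{SO}\text{ - }\mathrm{KROM}(\tau)$ consists of formulas $Q_1R_1\cdots Q_mR_m\forall\bar{x}(C_1\wedge\cdots\wedge C_n)$ with $Q_i\in\{\forall,\exists\}$, relation variables $R_i$, and each clause $C_j$ a disjunction $\beta_1\vee\cdots\vee\beta_q\vee H_1\vee H_2$ where each $\beta_s$ is $P\bar{y}$ or $\neg P\bar{y}$ with $P\in\tau$ and each $H_t$ is $R_i\bar{z}$, $\neg R_i\bar{z}$, or $\bot$. $\mathrm{SO}\text{ - }\mathrm{KROM}^r(\tau)$ is defined identically except that each $H_t$ may additionally be $\exists z_1\cdots\exists z_r\,R_iz_1\cdots z_r$ ($r$ the arity of $R_i$). $\Sigma^1_1\text{ - }\mathrm{KROM}$ and $\Sigma^1_1\text{ - }\mathrm{KROM}^r$ denote the respective formulas all of whose second-order quantifiers are existential. -}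

module Defs where

open import Data.Nat using (ℕ; suc)
open import Data.Fin using (Fin; zero; suc)
open import Data.Vec using (Vec; map)
open import Data.List using (List)
open import Data.List.Relation.Unary.All using (All)
open import Data.List.Relation.Unary.Any using (Any)
open import Data.Bool using (Bool; true)
open import Data.Product using (Σ; _×_)
open import Data.Sum using (_⊎_)
open import Data.Empty using (⊥)
open import Data.Unit using (⊤)
open import Relation.Nullary using (¬_)
open import Relation.Binary.PropositionalEquality using (_≡_)
open import Function.Bundles using (_⇔_)

record Vocab : Set where
  field
    nconst : ℕ
    nrel   : ℕ
    arity  : Fin nrel → ℕ
open Vocab public

-- Finite τ-structures, with nonempty universe {0,…,size}.

record Structure (τ : Vocab) : Set where
  field
    size  : ℕ
    const : Fin (nconst τ) → Fin (suc size)
    rel   : (P : Fin (nrel τ)) → Vec (Fin (suc size)) (arity τ P) → Bool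
open Structure public

Dom : {τ : Vocab} → Structure τ → Set
Dom A = Fin (suc (size A))

-- Syntax.
-- f : number of free first-order variables,
-- k : number of universally quantified first-order variables x̄,
-- m : number of second-order relation variables R₁ … Rₘ with arities ar.

data Term (τ : Vocab) (f k : ℕ) : Set where
  free  : Fin f → Term τ f k
  bound : Fin k → Term τ f k
  con   : Fin (nconst τ) → Term τ f k

data Atom (τ : Vocab) (f k : ℕ) : Set where
  eqA  : Term τ f k → Term τ f k → Atom τ f k
  relA : (P : Fin (nrel τ)) → Vec (Term τ f k) (arity τ P) → Atom τ f k

data Lit (τ : Vocab) (f k : ℕ) : Set where
  pos : Atom τ f k → Lit τ f k
  neg : Atom τ f k → Lit τ f k

-- H-literals: Rᵢ z̄, ¬ Rᵢ z̄, ⊥, or (only in KROMʳ) ∃z₁…∃zᵣ Rᵢ z₁…zᵣ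
data Head (τ : Vocab) (f k m : ℕ) (ar : Fin m → ℕ) : Set where
  posH : (i : Fin m) → Vec (Term τ f k) (ar i) → Head τ f k m ar
  negH : (i : Fin m) → Vec (Term τ f k) (ar i) → Head τ f k m ar
  botH : Head τ f k m ar
  exH  : (i : Fin m) → Head τ f k m ar

record Clause (τ : Vocab) (f k m : ℕ) (ar : Fin m → ℕ) : Set where
  constructor clause
  field
    betas : List (Lit τ f k)
    h₁ h₂ : Head τ f k m ar
open Clause public

data Quant : Set where
  ∀Q ∃Q : Quant

-- SO-KROMʳ(τ) formulas  Q₁R₁ ⋯ QₘRₘ ∀x̄ (C₁ ∧ ⋯ ∧ Cₙ)
-- with f free first-order variables.
record Formula (τ : Vocab) (f : ℕ) : Set where
  field
    m       : ℕ
    quants  : Fin m → Quant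
    arities : Fin m → ℕ
    k       : ℕ
    clauses : List (Clause τ f k m arities)
open Formula public

NoExHead : {τ : Vocab} {f k m : ℕ} {ar : Fin m → ℕ} → Head τ f k m ar → Set
NoExHead (exH _) = ⊥
NoExHead _       = ⊤

IsKrom : {τ : Vocab} {f : ℕ} → Formula τ f → Set
IsKrom φ = All (λ C → NoExHead (h₁ C) × NoExHead (h₂ C)) (clauses φ)

IsΣ¹₁ : {τ : Vocab} {f : ℕ} → Formula τ f → Set
IsΣ¹₁ φ = (i : Fin (m φ)) → quants φ i ≡ ∃Q

Rel : Set → ℕ → Set
Rel D r = Vec D r → Bool

RelEnv : Set → (m : ℕ) → (Fin m → ℕ) → Set
RelEnv D m ar = (i : Fin m) → Rel D (ar i)

extendEnv : {D : Set} {m : ℕ} {ar : Fin (suc m) → ℕ} →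
            Rel D (ar zero) → RelEnv D m (λ i → ar (suc i)) → RelEnv D (suc m) ar
extendEnv R ρ zero    = R
extendEnv R ρ (suc i) = ρ i

quantBlock : {D : Set} {r : ℕ} → Quant → (Rel D r → Set) → Set
quantBlock ∀Q F = ∀ R → F R
quantBlock ∃Q F = Σ _ F

quantify : (D : Set) (m : ℕ) (qs : Fin m → Quant) (ar : Fin m → ℕ) →
           (RelEnv D m ar → Set) → Set
quantify D ℕ.zero qs ar P = P (λ ())
quantify D (suc m) qs ar P =
  quantBlock (qs zero) λ R →
    quantify D m (λ i → qs (suc i)) (λ i → ar (suc i)) (λ ρ → P (extendEnv R ρ))

module _ {τ : Vocab} (A : Structure τ) {f k : ℕ}
         (a : Vec (Dom A) f) (b : Vec (Dom A) k) where

  evalTerm : Term τ f k → Dom A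
  evalTerm (free i)  = Data.Vec.lookup a i
  evalTerm (bound i) = Data.Vec.lookup b i
  evalTerm (con c)   = const A c

  AtomSat : Atom τ f k → Set
  AtomSat (eqA s t)   = evalTerm s ≡ evalTerm t
  AtomSat (relA P ts) = rel A P (map evalTerm ts) ≡ true

  LitSat : Lit τ f k → Set
  LitSat (pos α) = AtomSat α
  LitSat (neg α) = ¬ AtomSat α

  module _ {m : ℕ} {ar : Fin m → ℕ} (ρ : RelEnv (Dom A) m ar) where

    HeadSat : Head τ f k m ar → Set
    HeadSat (posH i ts) = ρ i (map evalTerm ts) ≡ true
    HeadSat (negH i ts) = ¬ (ρ i (map evalTerm ts) ≡ true)
    HeadSat botH        = ⊥
    HeadSat (exH i)     = Σ (Vec (Dom A) (ar i)) (λ z → ρ i z ≡ true)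

    ClauseSat : Clause τ f k m ar → Set
    ClauseSat C = Any LitSat (betas C) ⊎ (HeadSat (h₁ C) ⊎ HeadSat (h₂ C))

Sat : {τ : Vocab} {f : ℕ} (A : Structure τ) → Formula τ f → Vec (Dom A) f → Set
Sat A φ a =
  quantify (Dom A) (m φ) (quants φ) (arities φ) λ ρ →
    (b : Vec (Dom A) (k φ)) → All (ClauseSat A a b ρ) (clauses φ)

-- A head ∃z̄ Rᵢz̄ only asks that Rᵢ be nonempty. Since the universe is finite and
-- nonempty, a tuple ȳᵢ can be fixed that lies in Rᵢ whenever Rᵢ is nonempty at all;
-- replacing every such head by the Krom atom Rᵢȳᵢ, with the ȳᵢ as free variables
-- existentially quantified outside, preserves truth in both directions. So one
-- disjunct suffices: ∃ȳ₁⋯ȳₘ φ, where ȳᵢ has the arity of Rᵢ.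
module Submission where

open import Defs
open import Data.Nat using (ℕ; zero; suc; _+_)
open import Data.Fin using (Fin; zero; suc)
open import Data.Fin.Properties using (any?)
open import Data.Vec using (Vec; []; _∷_; _++_; take; drop; lookup; allFin; map; replicate)
open import Data.Vec.Properties using (++-injective; take++drop≡id; take-map; drop-map; map-∘; map-lookup-allFin)
open import Data.Bool using (Bool; true)
open import Data.Bool.Properties using (_≟_)
open import Data.Product using (Σ; ∃; _×_; _,_; proj₁; proj₂)
open import Data.Sum using () renaming (map to ⊎-map)
open import Data.Unit using (tt)
import Data.List as List
open import Data.List.Relation.Unary.All using (All; universal) renaming (map to All-map)
import Data.List.Relation.Unary.All.Properties as All
open import Data.List.Relation.Unary.Any using (Any) renaming (map to Any-map)
import Data.List.Relation.Unary.Any.Properties as Any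
open import Relation.Nullary using (¬_; Dec; yes; no; contradiction)
open import Relation.Nullary.Decidable using (map′)
open import Relation.Unary using (Pred; Decidable)
open import Relation.Binary.PropositionalEquality
open import Function using (_∘_; id)
open import Function.Bundles using (_⇔_; mk⇔; Equivalence)

totalArity : (m : ℕ) → (Fin m → ℕ) → ℕ
totalArity zero    ar = 0
totalArity (suc m) ar = ar zero + totalArity m (ar ∘ suc)

module _ {X : Set} where

  take-drop-++ : ∀ {n p} (xs : Vec X n) (ys : Vec X p) →
                 take n (xs ++ ys) ≡ xs × drop n (xs ++ ys) ≡ ys
  take-drop-++ {n} xs ys = ++-injective (take n (xs ++ ys)) xs (take++drop≡id n (xs ++ ys))

  joinBlocks : ∀ m ar → ((i : Fin m) → Vec X (ar i)) → Vec X (totalArity m ar)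
  joinBlocks zero    ar w = []
  joinBlocks (suc m) ar w = w zero ++ joinBlocks m (ar ∘ suc) (w ∘ suc)

  block : ∀ m ar → Vec X (totalArity m ar) → (i : Fin m) → Vec X (ar i)
  block (suc m) ar v zero    = take (ar zero) v
  block (suc m) ar v (suc i) = block m (ar ∘ suc) (drop (ar zero) v) i

  block-joinBlocks : ∀ m ar (w : (i : Fin m) → Vec X (ar i)) i →
                     block m ar (joinBlocks m ar w) i ≡ w i
  block-joinBlocks (suc m) ar w zero    = proj₁ (take-drop-++ (w zero) _)
  block-joinBlocks (suc m) ar w (suc i) = begin
    block m (ar ∘ suc) (drop (ar zero) (w zero ++ _)) i
      ≡⟨ cong (λ v → block m (ar ∘ suc) v i) (proj₂ (take-drop-++ (w zero) _)) ⟩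
    block m (ar ∘ suc) (joinBlocks m (ar ∘ suc) (w ∘ suc)) i
      ≡⟨ block-joinBlocks m (ar ∘ suc) (w ∘ suc) i ⟩
    w (suc i) ∎
    where open ≡-Reasoning

map-block : ∀ {X Y : Set} (f : X → Y) m ar (v : Vec X (totalArity m ar)) i →
            map f (block m ar v i) ≡ block m ar (map f v) i
map-block f (suc m) ar v zero    = sym (take-map f (ar zero) v)
map-block f (suc m) ar v (suc i) = begin
  map f (block m (ar ∘ suc) (drop (ar zero) v) i)
    ≡⟨ map-block f m (ar ∘ suc) (drop (ar zero) v) i ⟩
  block m (ar ∘ suc) (map f (drop (ar zero) v)) i
    ≡⟨ cong (λ u → block m (ar ∘ suc) u i) (sym (drop-map f (ar zero) v)) ⟩
  block m (ar ∘ suc) (drop (ar zero) (map f v)) i ∎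
  where open ≡-Reasoning

any-Vec? : ∀ {n p} r {P : Pred (Vec (Fin n) r) p} → Decidable P → Dec (∃ P)
any-Vec? zero    P? = map′ ([] ,_) (λ { ([] , p) → p }) (P? [])
any-Vec? (suc r) P? =
  map′ (λ { (x , xs , p) → x ∷ xs , p }) (λ { (x ∷ xs , p) → x , xs , p })
       (any? λ x → any-Vec? r (P? ∘ (x ∷_)))

-- The default tuple is where nonemptiness of the universe is used.
witnessIfSatisfiable : ∀ {s} r (R : Vec (Fin (suc s)) r → Bool) →
                       Σ (Vec (Fin (suc s)) r) λ w → ∀ z → R z ≡ true → R w ≡ true
witnessIfSatisfiable r R with any-Vec? r (λ z → R z ≟ true)
... | yes (w , Rw) = w , λ _ _ → Rw
... | no  ∄        = replicate r zero , λ z Rz → contradiction (z , Rz) ∄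

module _ {D : Set} where

  _≗ᴱ_ : ∀ {m ar} → RelEnv D m ar → RelEnv D m ar → Set
  _≗ᴱ_ {m} {ar} ρ ρ′ = (i : Fin m) (v : Vec D (ar i)) → ρ i v ≡ ρ′ i v

  extendEnv-cong : ∀ {m ar} (R : Rel D (ar zero)) {ρ ρ′ : RelEnv D m (ar ∘ suc)} →
                   ρ ≗ᴱ ρ′ → extendEnv {ar = ar} R ρ ≗ᴱ extendEnv R ρ′
  extendEnv-cong R eq zero    v = refl
  extendEnv-cong R eq (suc i) v = eq i v

  extendEnv-head-tail : ∀ {m ar} (ρ : RelEnv D (suc m) ar) → extendEnv (ρ zero) (ρ ∘ suc) ≗ᴱ ρ
  extendEnv-head-tail ρ zero    v = refl
  extendEnv-head-tail ρ (suc i) v = refl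

  quantify-∃⁻ : ∀ m qs ar {P : RelEnv D m ar → Set} → (∀ i → qs i ≡ ∃Q) →
                quantify D m qs ar P → Σ (RelEnv D m ar) P
  quantify-∃⁻ zero    qs ar all∃ p = (λ ()) , p
  quantify-∃⁻ (suc m) qs ar all∃ p with qs zero | all∃ zero
  ... | .∃Q | refl with quantify-∃⁻ m (qs ∘ suc) (ar ∘ suc) (all∃ ∘ suc) (proj₂ p)
  ...   | ρ , Pρ = extendEnv (proj₁ p) ρ , Pρ

  quantify-∃⁺ : ∀ m qs ar {P : RelEnv D m ar → Set} → (∀ i → qs i ≡ ∃Q) →
                (∀ {ρ ρ′} → ρ ≗ᴱ ρ′ → P ρ → P ρ′) →
                Σ (RelEnv D m ar) P → quantify D m qs ar P
  quantify-∃⁺ zero    qs ar all∃ resp (ρ , Pρ) = resp (λ ()) Pρ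
  quantify-∃⁺ (suc m) qs ar all∃ resp (ρ , Pρ) with qs zero | all∃ zero
  ... | .∃Q | refl =
    ρ zero , quantify-∃⁺ m (qs ∘ suc) (ar ∘ suc) (all∃ ∘ suc)
               (resp ∘ extendEnv-cong (ρ zero))
               (ρ ∘ suc , resp (λ i v → sym (extendEnv-head-tail ρ i v)) Pρ)

Matrix : {τ : Vocab} {f : ℕ} (A : Structure τ) (φ : Formula τ f) →
         Vec (Dom A) f → RelEnv (Dom A) (m φ) (arities φ) → Set
Matrix A φ a ρ = (b : Vec (Dom A) (k φ)) → All (ClauseSat A a b ρ) (clauses φ)

module _ {τ : Vocab} (A : Structure τ) {f k m : ℕ} {ar : Fin m → ℕ}
         {a : Vec (Dom A) f} {b : Vec (Dom A) k} {ρ ρ′ : RelEnv (Dom A) m ar} (eq : ρ ≗ᴱ ρ′) where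

  headSat-resp : (h : Head τ f k m ar) → HeadSat A a b ρ h → HeadSat A a b ρ′ h
  headSat-resp (posH i ts) sat      = trans (sym (eq i _)) sat
  headSat-resp (negH i ts) sat      = sat ∘ trans (eq i _)
  headSat-resp botH        ()
  headSat-resp (exH i)     (z , ρz) = z , trans (sym (eq i z)) ρz

  clauseSat-resp : (C : Clause τ f k m ar) → ClauseSat A a b ρ C → ClauseSat A a b ρ′ C
  clauseSat-resp C = ⊎-map id (⊎-map (headSat-resp (h₁ C)) (headSat-resp (h₂ C)))

matrix-resp : {τ : Vocab} {f : ℕ} (A : Structure τ) (φ : Formula τ f) {a : Vec (Dom A) f}
              {ρ ρ′ : RelEnv (Dom A) (m φ) (arities φ)} → ρ ≗ᴱ ρ′ → Matrix A φ a ρ → Matrix A φ a ρ′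
matrix-resp A φ eq M b = All-map (clauseSat-resp A eq _) (M b)

sat-Σ¹₁⇔ : {τ : Vocab} {f : ℕ} (A : Structure τ) (φ : Formula τ f) → IsΣ¹₁ φ →
           (a : Vec (Dom A) f) → Sat A φ a ⇔ Σ (RelEnv (Dom A) (m φ) (arities φ)) (Matrix A φ a)
sat-Σ¹₁⇔ A φ all∃ a = mk⇔
  (quantify-∃⁻ (m φ) (quants φ) (arities φ) all∃)
  (quantify-∃⁺ (m φ) (quants φ) (arities φ) all∃ (matrix-resp A φ))

module Instantiate {τ : Vocab} (ψ : Formula τ 0) {l : ℕ}
                   (ys : (i : Fin (m ψ)) → Vec (Term τ l (k ψ)) (arities ψ i)) where

  private
    K  = k ψ
    M  = m ψ
    ar = arities ψ

  weakenTerm : Term τ 0 K → Term τ l K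
  weakenTerm (bound i) = bound i
  weakenTerm (con c)   = con c

  weakenAtom : Atom τ 0 K → Atom τ l K
  weakenAtom (eqA s t)   = eqA (weakenTerm s) (weakenTerm t)
  weakenAtom (relA P ts) = relA P (map weakenTerm ts)

  weakenLit : Lit τ 0 K → Lit τ l K
  weakenLit (pos α) = pos (weakenAtom α)
  weakenLit (neg α) = neg (weakenAtom α)

  instHead : Head τ 0 K M ar → Head τ l K M ar
  instHead (posH i ts) = posH i (map weakenTerm ts)
  instHead (negH i ts) = negH i (map weakenTerm ts)
  instHead botH        = botH
  instHead (exH i)     = posH i (ys i)

  instClause : Clause τ 0 K M ar → Clause τ l K M ar
  instClause C = clause (List.map weakenLit (betas C)) (instHead (h₁ C)) (instHead (h₂ C))

  instantiate : Formula τ l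
  instantiate = record
    { m = M ; quants = quants ψ ; arities = ar ; k = K
    ; clauses = List.map instClause (clauses ψ) }

  instHead-noEx : (h : Head τ 0 K M ar) → NoExHead (instHead h)
  instHead-noEx (posH i ts) = tt
  instHead-noEx (negH i ts) = tt
  instHead-noEx botH        = tt
  instHead-noEx (exH i)     = tt

  instantiate-isKrom : IsKrom instantiate
  instantiate-isKrom =
    All.map⁺ (universal (λ C → instHead-noEx (h₁ C) , instHead-noEx (h₂ C)) (clauses ψ))

  module _ (A : Structure τ) (y : Vec (Dom A) l) (b : Vec (Dom A) K)
           (ρ : RelEnv (Dom A) M ar) where

    evalTerm-weaken : (t : Term τ 0 K) → evalTerm A y b (weakenTerm t) ≡ evalTerm A [] b t
    evalTerm-weaken (bound i) = refl
    evalTerm-weaken (con c)   = refl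

    evalTerms-weaken : ∀ {n} (ts : Vec (Term τ 0 K) n) →
                       map (evalTerm A y b) (map weakenTerm ts) ≡ map (evalTerm A [] b) ts
    evalTerms-weaken []       = refl
    evalTerms-weaken (t ∷ ts) = cong₂ _∷_ (evalTerm-weaken t) (evalTerms-weaken ts)

    atomSat-weaken : (α : Atom τ 0 K) → AtomSat A y b (weakenAtom α) ≡ AtomSat A [] b α
    atomSat-weaken (eqA s t)   = cong₂ _≡_ (evalTerm-weaken s) (evalTerm-weaken t)
    atomSat-weaken (relA P ts) = cong (λ v → rel A P v ≡ true) (evalTerms-weaken ts)

    litSat-weaken : (x : Lit τ 0 K) → LitSat A y b (weakenLit x) ≡ LitSat A [] b x
    litSat-weaken (pos α) = atomSat-weaken α
    litSat-weaken (neg α) = cong ¬_ (atomSat-weaken α)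

    litsSat-weaken⁺ : (ls : List.List (Lit τ 0 K)) →
                      Any (LitSat A [] b) ls → Any (LitSat A y b) (List.map weakenLit ls)
    litsSat-weaken⁺ ls = Any.map⁺ ∘ Any-map (λ {x} → subst id (sym (litSat-weaken x)))

    litsSat-weaken⁻ : (ls : List.List (Lit τ 0 K)) →
                      Any (LitSat A y b) (List.map weakenLit ls) → Any (LitSat A [] b) ls
    litsSat-weaken⁻ ls = Any-map (λ {x} → subst id (litSat-weaken x)) ∘ Any.map⁻

    ExHeadsWitnessed : Set
    ExHeadsWitnessed = ∀ i → Σ (Vec (Dom A) (ar i)) (λ z → ρ i z ≡ true) →
                       ρ i (map (evalTerm A y b) (ys i)) ≡ true

    headSat-inst⁺ : ExHeadsWitnessed → (h : Head τ 0 K M ar) →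
                    HeadSat A [] b ρ h → HeadSat A y b ρ (instHead h)
    headSat-inst⁺ wit (posH i ts) sat = subst (λ v → ρ i v ≡ true) (sym (evalTerms-weaken ts)) sat
    headSat-inst⁺ wit (negH i ts) sat = sat ∘ subst (λ v → ρ i v ≡ true) (evalTerms-weaken ts)
    headSat-inst⁺ wit botH        ()
    headSat-inst⁺ wit (exH i)     sat = wit i sat

    headSat-inst⁻ : (h : Head τ 0 K M ar) → HeadSat A y b ρ (instHead h) → HeadSat A [] b ρ h
    headSat-inst⁻ (posH i ts) sat = subst (λ v → ρ i v ≡ true) (evalTerms-weaken ts) sat
    headSat-inst⁻ (negH i ts) sat = sat ∘ subst (λ v → ρ i v ≡ true) (sym (evalTerms-weaken ts))
    headSat-inst⁻ botH        ()
    headSat-inst⁻ (exH i)     sat = _ , sat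

    clauseSat-inst⁺ : ExHeadsWitnessed → (C : Clause τ 0 K M ar) →
                      ClauseSat A [] b ρ C → ClauseSat A y b ρ (instClause C)
    clauseSat-inst⁺ wit C =
      ⊎-map (litsSat-weaken⁺ (betas C)) (⊎-map (headSat-inst⁺ wit (h₁ C)) (headSat-inst⁺ wit (h₂ C)))

    clauseSat-inst⁻ : (C : Clause τ 0 K M ar) →
                      ClauseSat A y b ρ (instClause C) → ClauseSat A [] b ρ C
    clauseSat-inst⁻ C =
      ⊎-map (litsSat-weaken⁻ (betas C)) (⊎-map (headSat-inst⁻ (h₁ C)) (headSat-inst⁻ (h₂ C)))

  matrix-instantiate⁺ : (A : Structure τ) (y : Vec (Dom A) l) (ρ : RelEnv (Dom A) M ar) →
                        (∀ b → ExHeadsWitnessed A y b ρ) →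
                        Matrix A ψ [] ρ → Matrix A instantiate y ρ
  matrix-instantiate⁺ A y ρ wit M b = All.map⁺ (All-map (clauseSat-inst⁺ A y b ρ (wit b) _) (M b))

  matrix-instantiate⁻ : (A : Structure τ) (y : Vec (Dom A) l) (ρ : RelEnv (Dom A) M ar) →
                        Matrix A instantiate y ρ → Matrix A ψ [] ρ
  matrix-instantiate⁻ A y ρ M b = All-map (clauseSat-inst⁻ A y b ρ _) (All.map⁻ (M b))

blockVars : ∀ {τ k} m ar (i : Fin m) → Vec (Term τ (totalArity m ar) k) (ar i)
blockVars m ar i = map free (block m ar (allFin _) i)

evalTerms-blockVars : ∀ {τ k} (A : Structure τ) m ar (y : Vec (Dom A) (totalArity m ar))
                      (b : Vec (Dom A) k) i →
                      map (evalTerm A y b) (blockVars m ar i) ≡ block m ar y i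
evalTerms-blockVars A m ar y b i = begin
  map (evalTerm A y b) (map free (block m ar (allFin _) i)) ≡⟨ map-∘ (evalTerm A y b) free _ ⟨
  map (lookup y) (block m ar (allFin _) i)                  ≡⟨ map-block (lookup y) m ar (allFin _) i ⟩
  block m ar (map (lookup y) (allFin _)) i                  ≡⟨ cong (λ v → block m ar v i) (map-lookup-allFin y) ⟩
  block m ar y i                                            ∎
  where open ≡-Reasoning

blockVars-witnessing : {τ : Vocab} (ψ : Formula τ 0) (A : Structure τ)
                       (ρ : RelEnv (Dom A) (m ψ) (arities ψ)) →
                       Σ (Vec (Dom A) (totalArity (m ψ) (arities ψ))) λ y →
                       ∀ b → Instantiate.ExHeadsWitnessed ψ (blockVars (m ψ) (arities ψ)) A y b ρ
blockVars-witnessing ψ A ρ = y , λ b i (z , ρz) →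
  subst (λ v → ρ i v ≡ true)
        (sym (trans (evalTerms-blockVars A M ar y b i) (block-joinBlocks M ar w i)))
        (proj₂ (witnessIfSatisfiable (ar i) (ρ i)) z ρz)
  where
    M  = m ψ
    ar = arities ψ
    w : (i : Fin M) → Vec (Dom A) (ar i)
    w i = proj₁ (witnessIfSatisfiable (ar i) (ρ i))
    y = joinBlocks M ar w

proposition2p4 : (τ : Vocab) (ψ : Formula τ 0) → IsΣ¹₁ ψ →
    Σ ℕ λ n → Σ (Fin n → ℕ) λ l →
      Σ ((i : Fin n) → Formula τ (l i)) λ φ →
        ((i : Fin n) → IsΣ¹₁ (φ i) × IsKrom (φ i)) ×
        ((A : Structure τ) →
          Sat A ψ [] ⇔ Σ (Fin n) λ i → Σ (Vec (Dom A) (l i)) λ y → Sat A (φ i) y)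
proposition2p4 τ ψ ψ-Σ¹₁ =
  1 , (λ _ → L) , (λ _ → φ) , (λ _ → ψ-Σ¹₁ , instantiate-isKrom) , λ A → mk⇔ (to A) (from A)
  where
    L = totalArity (m ψ) (arities ψ)
    open Instantiate ψ (blockVars (m ψ) (arities ψ))
    φ = instantiate

    to : (A : Structure τ) → Sat A ψ [] → Σ (Fin 1) λ _ → Σ (Vec (Dom A) L) (Sat A φ)
    to A sat with Equivalence.to (sat-Σ¹₁⇔ A ψ ψ-Σ¹₁ []) sat
    ... | ρ , Mψ with blockVars-witnessing ψ A ρ
    ...   | y , wit = zero , y , Equivalence.from (sat-Σ¹₁⇔ A φ ψ-Σ¹₁ y)
                                   (ρ , matrix-instantiate⁺ A y ρ wit Mψ)

    from : (A : Structure τ) → (Σ (Fin 1) λ _ → Σ (Vec (Dom A) L) (Sat A φ)) → Sat A ψ []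
    from A (_ , y , sat) with Equivalence.to (sat-Σ¹₁⇔ A φ ψ-Σ¹₁ y) sat
    ... | ρ , Mφ = Equivalence.from (sat-Σ¹₁⇔ A ψ ψ-Σ¹₁ []) (ρ , matrix-instantiate⁻ A y ρ Mφ)
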